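{- In a projective Q-structure, for any $A,B\subseteq\mathcal P$: $A^\perp\subseteq(B\cdot A)^\perp$ and $A\subseteq(B\cdot A^\perp)^\perp$.
   Context: A Q-structure is a tuple $\langle\mathcal P,\mathcal Z,\cdot,1\rangle$ with $\mathcal P$ a set, $\mathcal Z\subseteq\mathcal P$, $\cdot$ a binary operation on $\mathcal P$ (not assumed associative or commutative), and $1\in\mathcal P$. These satisfy, for all $x,y,z$: $x\cdot y\in\mathcal Z$ iff $y\cdot x\in\mathcal Z$; $(x\cdot y)\cdot z\in\mathcal Z$ iff $x\cdot(z\cdot y)\in\mathcal Z$; and $1\cdot x=x\cdot1=x$. It is projective if $x\cdot y\in\mathcal Z$ for every $x\in\mathcal Z$ and every $y\in\mathcal P$. For $A\subseteq\mathcal P$, $A^\perp=\{b: b\cdot a\in\mathcal Z\ \forall a\in A\}$. For $A,B\subseteq\mathcal P$, $A\cdot B=\{a\cdot b:a\in A,b\in B\}$. -}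

module Defs where

open import Level using (Level; _⊔_; suc)
open import Data.Product using (Σ; _×_; _,_; ∃₂)
open import Relation.Binary.PropositionalEquality using (_≡_)
open import Relation.Unary using (Pred; _∈_; _⊆_)
open import Function.Bundles using (_⇔_)

record QStructure (a ℓ : Level) : Set (Level.suc (a ⊔ ℓ)) where
  field
    P     : Set a
    Z     : Pred P ℓ
    _·_   : P → P → P
    one   : P
    comm-Z  : ∀ x y → ((x · y) ∈ Z) ⇔ ((y · x) ∈ Z)
    assoc-Z : ∀ x y z → (((x · y) · z) ∈ Z) ⇔ ((x · (z · y)) ∈ Z)
    unitˡ : ∀ x → one · x ≡ x
    unitʳ : ∀ x → x · one ≡ x

  IsProjective : Set (a ⊔ ℓ)
  IsProjective = ∀ x y → x ∈ Z → (x · y) ∈ Z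

  _⊥ : ∀ {r} → Pred P r → Pred P (a ⊔ ℓ ⊔ r)
  (A ⊥) b = ∀ x → x ∈ A → (b · x) ∈ Z

  _·ˢ_ : ∀ {r s} → Pred P r → Pred P s → Pred P (a ⊔ r ⊔ s)
  (A ·ˢ B) c = ∃₂ λ x y → x ∈ A × y ∈ B × (x · y) ≡ c

{-# OPTIONS --safe #-}
module Submission where

open import Defs
open import Level using (Level)
open import Data.Product using (_×_; _,_)
open import Relation.Unary using (Pred; _∈_; _⊆_)
open import Relation.Binary.PropositionalEquality using (refl)
open import Function.Bundles using (Equivalence)

module Projective {a ℓ : Level} (Q : QStructure a ℓ) (proj : QStructure.IsProjective Q) where

  open QStructure Q

  -- Projectivity gives (c · y) · b ∈ Z, and the twisted associativity moves b inside.
  ·-absorbˡ-Z : ∀ c y b → (c · y) ∈ Z → (c · (b · y)) ∈ Z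
  ·-absorbˡ-Z c y b cy∈Z = Equivalence.to (assoc-Z c y b) (proj (c · y) b cy∈Z)

  ⊥-⊆-·ˢ-⊥ : ∀ {r s} (A : Pred P r) (B : Pred P s) → A ⊥ ⊆ (B ·ˢ A) ⊥
  ⊥-⊆-·ˢ-⊥ A B {c} c∈A⊥ _ (b , y , _ , y∈A , refl) = ·-absorbˡ-Z c y b (c∈A⊥ y y∈A)

  ⊆-·ˢ-⊥-⊥ : ∀ {r s} (A : Pred P r) (B : Pred P s) → A ⊆ (B ·ˢ (A ⊥)) ⊥
  ⊆-·ˢ-⊥-⊥ A B {x} x∈A _ (b , c , _ , c∈A⊥ , refl) =
    ·-absorbˡ-Z x c b (Equivalence.to (comm-Z c x) (c∈A⊥ x x∈A))

lemma19 : ∀ {a ℓ r s : Level} (Q : QStructure a ℓ) → QStructure.IsProjective Q →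
    (A : Pred (QStructure.P Q) r) (B : Pred (QStructure.P Q) s) →
    (QStructure._⊥ Q A ⊆ QStructure._⊥ Q (QStructure._·ˢ_ Q B A))
    × (A ⊆ QStructure._⊥ Q (QStructure._·ˢ_ Q B (QStructure._⊥ Q A)))
lemma19 Q proj A B = ⊥-⊆-·ˢ-⊥ A B , ⊆-·ˢ-⊥-⊥ A B
  where open Projective Q proj
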